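{- Let $k,\ell$ be positive integers with $\ell\geq k$, let $b\in[\ell-k+1]$, let $\mu\in\mathcal{P}^\ell$ (regarded as a weakly decreasing function $[\ell]\to[\ell]$), and put $b'=\ell-k-b+2$. Say that a $\nu\in\mathcal{P}^\ell$ satisfies conditions (i)–(iii) for $c\in[\ell-k+1]$ if: (i) $\nu(c)=c+k-1$ and $\nu(c+k-1)=c$; (ii) $\nu(\nu(i))>i$ for all $1\leq i<c$; (iii) $\nu(\nu(i))<i$ for all $c+k-1<i\leq\ell$. Then: (a) $\mu$ satisfies (i)–(iii) for $b$ if and only if $\tau_\ell(\mu)$ satisfies (i)–(iii) for $b'$. (b) Define $\tilde\lambda(i)=\mu(b+i-1)-b+1$ and $\tilde{\lambda}'(i)=\tau_\ell(\mu)(b'+i-1)-b'+1$ for $1\leq i\leq k$. Then $\tilde\lambda'(i)=k+1-\tilde\lambda(k+1-i)$ for all $i\in[k]$; that is, $\tau_k(\tilde\lambda)=\tilde\lambda'$ (in particular whenever $\tilde\lambda,\tilde\lambda'\in\mathcal{P}_{\rm sq}^k$).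
   Context: $[n]=\{1,\dots,n\}$. A partition with $n$ parts is a weakly decreasing sequence of $n$ positive integers, identified with the function $[n]\to\mathbb{Z}^+$, $i\mapsto\lambda_i$. $\mathcal{P}^{n,k}$ is the set of partitions with exactly $n$ parts all at most $k$; $\mathcal{P}^k=\mathcal{P}^{k,k}$. $\tau_k(\lambda_1,\dots,\lambda_n)=(k+1-\lambda_n,\dots,k+1-\lambda_1)$, i.e. $\tau_k(\lambda)(i)=k+1-\lambda(n+1-i)$. $\mathcal{P}_{\rm sq}^k=\{\lambda\in\mathcal{P}^k:\lambda_1=k,\ \lambda_k=1\}$. -}

module Defs where

open import Data.Nat using (ℕ; suc; _+_; _∸_; _≤_; _<_)
open import Data.Integer as ℤ using (ℤ; +_)
open import Data.Product using (_×_)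
open import Relation.Binary.PropositionalEquality using (_≡_)

-- A sequence is modelled as a function ℕ → ℕ; only its values at
-- indices 1..n matter.
IsPartition : ℕ → ℕ → (ℕ → ℕ) → Set
IsPartition n k f =
  (∀ i → 1 ≤ i → i ≤ n → (1 ≤ f i × f i ≤ k)) ×
  (∀ i j → 1 ≤ i → i ≤ j → j ≤ n → f j ≤ f i)

-- τ_k on a sequence with n parts: τ_k(λ)(i) = k+1 - λ(n+1-i).
-- (For λ ∈ 𝒫^{n,k} and i ∈ [n] the truncated subtractions are exact.)
τ : ℕ → ℕ → (ℕ → ℕ) → (ℕ → ℕ)
τ k n f i = suc k ∸ f (suc n ∸ i)

τℤ : ℕ → ℕ → (ℕ → ℤ) → (ℕ → ℤ)
τℤ k n f i = (+ suc k) ℤ.- f (suc n ∸ i)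

Conds : ℕ → ℕ → ℕ → (ℕ → ℕ) → Set
Conds ℓ k c ν =
  (ν c ≡ c + k ∸ 1 × ν (c + k ∸ 1) ≡ c) ×
  (∀ i → 1 ≤ i → i < c → i < ν (ν i)) ×
  (∀ i → c + k ∸ 1 < i → i ≤ ℓ → ν (ν i) < i)

b′ : ℕ → ℕ → ℕ → ℕ
b′ ℓ k b = (ℓ + 2) ∸ (k + b)

shiftSeq : (ℕ → ℕ) → ℕ → ℕ → ℤ
shiftSeq μ b i = ((+ μ (b + i ∸ 1)) ℤ.- (+ b)) ℤ.+ (+ 1)

module Submission where

-- Write σ j = (ℓ+1) − j for the order-reversing involution of [1,ℓ].
-- By definition ν = τ_ℓ(μ) is the conjugate σ ∘ μ ∘ σ, hence ν ∘ ν is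
-- the conjugate σ ∘ (μ ∘ μ) ∘ σ, and conjugation by σ is symmetric.
-- If k + b + c = ℓ + 2, then σ maps the block [b, b+k−1] onto
-- [c, c+k−1] reversing it: σ(c+i−1) = b+(k+1−i)−1.  Conjugation by σ
-- therefore swaps the endpoint equations (i) of the two blocks and, since
-- σ reverses the order, turns condition (ii) below one block into
-- condition (iii) above the other.  This gives one direction of (a); the
-- other is the same statement for the conjugate pair read backwards.
-- Part (b) is the index identity above followed by integer arithmetic.
-- Finally, b' = ℓ−k−b+2 is exactly the c with k + b + c = ℓ + 2.

open import Defs
open import Data.Nat using (ℕ; suc; _+_; _∸_; _≤_; _<_; z≤n; s≤s)
open import Data.Nat.Properties
open import Data.Nat.Tactic.RingSolver using (solve-∀)
open import Data.Integer as ℤ using (ℤ; +_; 1ℤ)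
import Data.Integer.Properties as ℤP
import Data.Integer.Tactic.RingSolver as ℤSolver
open import Data.Product using (_×_; _,_; proj₁; proj₂)
open import Function.Bundles using (_⇔_; mk⇔)
open import Relation.Binary.PropositionalEquality
  using (_≡_; refl; sym; trans; cong; subst; module ≡-Reasoning)

reflect-≤ : ∀ ℓ {j} → 1 ≤ j → suc ℓ ∸ j ≤ ℓ
reflect-≤ ℓ {suc j} _ = m∸n≤m ℓ j

reflect-range : ∀ ℓ {j} → 1 ≤ j → j ≤ ℓ → 1 ≤ suc ℓ ∸ j × suc ℓ ∸ j ≤ ℓ
reflect-range ℓ j≥1 j≤ℓ = m<n⇒0<n∸m (s≤s j≤ℓ) , reflect-≤ ℓ j≥1

reflect-swap-< : ∀ {N x y} → y ≤ N → x < N ∸ y → y < N ∸ x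
reflect-swap-< {N} {x} {y} y≤N x<σy =
  m+n≤o⇒m≤o∸n (suc y) (subst (_≤ N) (cong suc (+-comm x y)) (m≤o∸n⇒m+n≤o (suc x) y≤N x<σy))

+-suc-∸1 : ∀ m n → m + suc n ∸ 1 ≡ m + n
+-suc-∸1 m n = cong (_∸ 1) (+-suc m n)

block-start≤end : ∀ m {n} → 1 ≤ n → m ≤ m + n ∸ 1
block-start≤end m {n} n≥1 = subst (m ≤_) (sym (+-∸-assoc m n≥1)) (m≤m+n m (n ∸ 1))

MapsInto : ℕ → (ℕ → ℕ) → Set
MapsInto ℓ f = ∀ i → 1 ≤ i → i ≤ ℓ → 1 ≤ f i × f i ≤ ℓ

-- On [1,ℓ], g = σ ∘ f ∘ σ.  The pair (μ, τ ℓ ℓ μ) is conjugate by definition.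
Conjugate : ℕ → (ℕ → ℕ) → (ℕ → ℕ) → Set
Conjugate ℓ f g = ∀ i → 1 ≤ i → i ≤ ℓ → g i ≡ suc ℓ ∸ f (suc ℓ ∸ i)

module Conjugation {ℓ : ℕ} {f g : ℕ → ℕ} (f-maps : MapsInto ℓ f) (conj : Conjugate ℓ f g) where

  -- Values of f and of f ∘ f stay within the range where σ is an involution.
  f≤1+ℓ : ∀ i → 1 ≤ i → i ≤ ℓ → f i ≤ suc ℓ
  f≤1+ℓ i i≥1 i≤ℓ = m≤n⇒m≤1+n (proj₂ (f-maps i i≥1 i≤ℓ))

  ff≤1+ℓ : ∀ i → 1 ≤ i → i ≤ ℓ → f (f i) ≤ suc ℓ
  ff≤1+ℓ i i≥1 i≤ℓ = f≤1+ℓ (f i) (proj₁ (f-maps i i≥1 i≤ℓ)) (proj₂ (f-maps i i≥1 i≤ℓ))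

  maps : MapsInto ℓ g
  maps i i≥1 i≤ℓ = subst (λ v → 1 ≤ v × v ≤ ℓ) (sym (conj i i≥1 i≤ℓ)) (reflect-range ℓ fσi≥1 fσi≤ℓ)
    where
    σi : 1 ≤ suc ℓ ∸ i × suc ℓ ∸ i ≤ ℓ
    σi = reflect-range ℓ i≥1 i≤ℓ
    fσi≥1 : 1 ≤ f (suc ℓ ∸ i)
    fσi≥1 = proj₁ (f-maps (suc ℓ ∸ i) (proj₁ σi) (proj₂ σi))
    fσi≤ℓ : f (suc ℓ ∸ i) ≤ ℓ
    fσi≤ℓ = proj₂ (f-maps (suc ℓ ∸ i) (proj₁ σi) (proj₂ σi))

  -- Since σ is an involution, conjugacy is symmetric.
  symmetric : Conjugate ℓ g f
  symmetric i i≥1 i≤ℓ = begin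
    f i                                       ≡⟨ m∸[m∸n]≡n (f≤1+ℓ i i≥1 i≤ℓ) ⟨
    suc ℓ ∸ (suc ℓ ∸ f i)                     ≡⟨ cong (λ j → suc ℓ ∸ (suc ℓ ∸ f j)) (m∸[m∸n]≡n (m≤n⇒m≤1+n i≤ℓ)) ⟨
    suc ℓ ∸ (suc ℓ ∸ f (suc ℓ ∸ (suc ℓ ∸ i))) ≡⟨ cong (suc ℓ ∸_) (conj (suc ℓ ∸ i) (proj₁ σi) (proj₂ σi)) ⟨
    suc ℓ ∸ g (suc ℓ ∸ i)                     ∎
    where
    open ≡-Reasoning
    σi : 1 ≤ suc ℓ ∸ i × suc ℓ ∸ i ≤ ℓ
    σi = reflect-range ℓ i≥1 i≤ℓ

  square : ∀ i → 1 ≤ i → i ≤ ℓ → g (g i) ≡ suc ℓ ∸ f (f (suc ℓ ∸ i))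
  square i i≥1 i≤ℓ = begin
    g (g i)                               ≡⟨ conj (g i) (proj₁ (maps i i≥1 i≤ℓ)) (proj₂ (maps i i≥1 i≤ℓ)) ⟩
    suc ℓ ∸ f (suc ℓ ∸ g i)               ≡⟨ cong (λ j → suc ℓ ∸ f (suc ℓ ∸ j)) (conj i i≥1 i≤ℓ) ⟩
    suc ℓ ∸ f (suc ℓ ∸ (suc ℓ ∸ f σi))    ≡⟨ cong (λ j → suc ℓ ∸ f j) (m∸[m∸n]≡n (f≤1+ℓ σi σi≥1 σi≤ℓ)) ⟩
    suc ℓ ∸ f (f σi)                      ∎
    where
    open ≡-Reasoning
    σi : ℕ
    σi = suc ℓ ∸ i
    σi≥1 : 1 ≤ σi
    σi≥1 = proj₁ (reflect-range ℓ i≥1 i≤ℓ)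
    σi≤ℓ : σi ≤ ℓ
    σi≤ℓ = proj₂ (reflect-range ℓ i≥1 i≤ℓ)

  -- σ reverses order, so "f∘f moves points up below s" becomes
  -- "g∘g moves points down above e" whenever σ e = s.
  below-to-above : ∀ {s e} → suc ℓ ∸ e ≡ s →
    (∀ i → 1 ≤ i → i < s → i < f (f i)) → (∀ i → e < i → i ≤ ℓ → g (g i) < i)
  below-to-above {s} {e} σe≡s up i e<i i≤ℓ = subst (_< i) (sym (square i i≥1 i≤ℓ))
      (subst (suc ℓ ∸ f (f j) <_) (m∸[m∸n]≡n (m≤n⇒m≤1+n i≤ℓ))
        (∸-monoʳ-< (up j j≥1 j<s) (ff≤1+ℓ j j≥1 j≤ℓ)))
    where
    i≥1 : 1 ≤ i
    i≥1 = ≤-trans (s≤s z≤n) e<i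
    j : ℕ
    j = suc ℓ ∸ i
    j≥1 : 1 ≤ j
    j≥1 = proj₁ (reflect-range ℓ i≥1 i≤ℓ)
    j≤ℓ : j ≤ ℓ
    j≤ℓ = proj₂ (reflect-range ℓ i≥1 i≤ℓ)
    j<s : j < s
    j<s = subst (j <_) σe≡s (∸-monoʳ-< e<i (m≤n⇒m≤1+n i≤ℓ))

  above-to-below : ∀ {s e} → s ≤ ℓ → suc ℓ ∸ s ≡ e →
    (∀ i → e < i → i ≤ ℓ → f (f i) < i) → (∀ i → 1 ≤ i → i < s → i < g (g i))
  above-to-below {s} {e} s≤ℓ σs≡e down i i≥1 i<s = subst (i <_) (sym (square i i≥1 i≤ℓ))
      (reflect-swap-< (m≤n⇒m≤1+n i≤ℓ) (down j e<j j≤ℓ))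
    where
    i≤ℓ : i ≤ ℓ
    i≤ℓ = <⇒≤ (<-≤-trans i<s s≤ℓ)
    j : ℕ
    j = suc ℓ ∸ i
    j≤ℓ : j ≤ ℓ
    j≤ℓ = proj₂ (reflect-range ℓ i≥1 i≤ℓ)
    e<j : e < j
    e<j = subst (_< j) σs≡e (∸-monoʳ-< i<s (m≤n⇒m≤1+n s≤ℓ))

-- The blocks [b, b+k−1] and [c, c+k−1] of [1,ℓ] are mirror images under σ.
record MirrorBlocks (ℓ k b c : ℕ) : Set where
  field
    k≥1   : 1 ≤ k
    b≥1   : 1 ≤ b
    c≥1   : 1 ≤ c
    total : k + b + c ≡ 2 + ℓ

mirror-sym : ∀ {ℓ k b c} → MirrorBlocks ℓ k b c → MirrorBlocks ℓ k c b
mirror-sym {ℓ} {k} {b} {c} m = record { k≥1 = k≥1 ; b≥1 = c≥1 ; c≥1 = b≥1 ; total = trans (swap k b c) total }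
  where
  open MirrorBlocks m
  swap : ∀ k b c → k + c + b ≡ k + b + c
  swap = solve-∀

reflect-offset : ∀ {ℓ b c} k₀ {i₀} → i₀ ≤ k₀ → k₀ + b + c ≡ suc ℓ → suc ℓ ∸ (c + i₀) ≡ b + (k₀ ∸ i₀)
reflect-offset {ℓ} {b} {c} k₀ {i₀} i₀≤k₀ sum = begin
  suc ℓ ∸ (c + i₀)                              ≡⟨ cong (_∸ (c + i₀)) (sym sum) ⟩
  k₀ + b + c ∸ (c + i₀)                         ≡⟨ cong (λ n → n + b + c ∸ (c + i₀)) (m∸n+n≡m i₀≤k₀) ⟨
  (k₀ ∸ i₀) + i₀ + b + c ∸ (c + i₀)             ≡⟨ cong (_∸ (c + i₀)) (regroup (k₀ ∸ i₀) i₀ b c) ⟩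
  b + (k₀ ∸ i₀) + (c + i₀) ∸ (c + i₀)           ≡⟨ m+n∸n≡m (b + (k₀ ∸ i₀)) (c + i₀) ⟩
  b + (k₀ ∸ i₀)                                 ∎
  where
  open ≡-Reasoning
  regroup : ∀ d i b c → d + i + b + c ≡ b + d + (c + i)
  regroup = solve-∀

reflect-index : ∀ {ℓ k b c} → MirrorBlocks ℓ k b c →
  ∀ {i} → 1 ≤ i → i ≤ k → suc ℓ ∸ (c + i ∸ 1) ≡ b + (suc k ∸ i) ∸ 1
reflect-index {ℓ} {suc k₀} {b} {c} m {suc i₀} _ (s≤s i₀≤k₀) = begin
  suc ℓ ∸ (c + suc i₀ ∸ 1)     ≡⟨ cong (suc ℓ ∸_) (+-suc-∸1 c i₀) ⟩
  suc ℓ ∸ (c + i₀)             ≡⟨ reflect-offset k₀ i₀≤k₀ (suc-injective (MirrorBlocks.total m)) ⟩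
  b + (k₀ ∸ i₀)                ≡⟨ +-suc-∸1 b (k₀ ∸ i₀) ⟨
  b + suc (k₀ ∸ i₀) ∸ 1        ≡⟨ cong (λ n → b + n ∸ 1) (+-∸-assoc 1 i₀≤k₀) ⟨
  b + (suc k₀ ∸ i₀) ∸ 1        ∎
  where open ≡-Reasoning

reflect-start : ∀ {ℓ k b c} → MirrorBlocks ℓ k b c → suc ℓ ∸ c ≡ b + k ∸ 1
reflect-start {ℓ} {k} {b} {c} m =
  subst (λ j → suc ℓ ∸ j ≡ b + k ∸ 1) (m+n∸n≡m c 1) (reflect-index m ≤-refl (MirrorBlocks.k≥1 m))

reflect-end : ∀ {ℓ k b c} → MirrorBlocks ℓ k b c → suc ℓ ∸ (c + k ∸ 1) ≡ b
reflect-end {ℓ} {k} {b} {c} m = begin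
  suc ℓ ∸ (c + k ∸ 1)     ≡⟨ reflect-index m (MirrorBlocks.k≥1 m) ≤-refl ⟩
  b + (suc k ∸ k) ∸ 1     ≡⟨ cong (λ n → b + n ∸ 1) (m+n∸n≡m 1 k) ⟩
  b + 1 ∸ 1               ≡⟨ m+n∸n≡m b 1 ⟩
  b                       ∎
  where open ≡-Reasoning

-- The block at c lies inside [1,ℓ]: its end is the reflection of b ≥ 1.
block-end≤ℓ : ∀ {ℓ k b c} → MirrorBlocks ℓ k b c → c + k ∸ 1 ≤ ℓ
block-end≤ℓ {ℓ} m = subst (_≤ ℓ) (reflect-start (mirror-sym m)) (reflect-≤ ℓ (MirrorBlocks.b≥1 m))

block-position : ∀ {ℓ k b c} → MirrorBlocks ℓ k b c →
  ∀ {i} → 1 ≤ i → i ≤ k → 1 ≤ c + i ∸ 1 × c + i ∸ 1 ≤ ℓ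
block-position {c = c} m i≥1 i≤k =
  ≤-trans (MirrorBlocks.c≥1 m) (block-start≤end c i≥1) ,
  ≤-trans (∸-monoˡ-≤ 1 (+-monoʳ-≤ c i≤k)) (block-end≤ℓ m)

conds-transfer : ∀ {ℓ k b c} {f g : ℕ → ℕ} → MirrorBlocks ℓ k b c →
  MapsInto ℓ f → Conjugate ℓ f g → Conds ℓ k b f → Conds ℓ k c g
conds-transfer {ℓ} {k} {b} {c} {f} {g} m f-maps conj ((fb≡B , fB≡b) , up , down) =
  (gc≡C , gC≡c) , above-to-below c≤ℓ (reflect-start m) down , below-to-above (reflect-end m) up
  where
  open Conjugation f-maps conj
  open MirrorBlocks m using (k≥1; c≥1)
  open ≡-Reasoning
  c≤ℓ : c ≤ ℓ
  c≤ℓ = ≤-trans (block-start≤end c k≥1) (block-end≤ℓ m)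
  C-range : 1 ≤ c + k ∸ 1 × c + k ∸ 1 ≤ ℓ
  C-range = block-position m k≥1 ≤-refl
  gc≡C : g c ≡ c + k ∸ 1
  gc≡C = begin
    g c                       ≡⟨ conj c c≥1 c≤ℓ ⟩
    suc ℓ ∸ f (suc ℓ ∸ c)     ≡⟨ cong (λ j → suc ℓ ∸ f j) (reflect-start m) ⟩
    suc ℓ ∸ f (b + k ∸ 1)     ≡⟨ cong (suc ℓ ∸_) fB≡b ⟩
    suc ℓ ∸ b                 ≡⟨ reflect-start (mirror-sym m) ⟩
    c + k ∸ 1                 ∎
  gC≡c : g (c + k ∸ 1) ≡ c
  gC≡c = begin
    g (c + k ∸ 1)                     ≡⟨ conj (c + k ∸ 1) (proj₁ C-range) (proj₂ C-range) ⟩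
    suc ℓ ∸ f (suc ℓ ∸ (c + k ∸ 1))   ≡⟨ cong (λ j → suc ℓ ∸ f j) (reflect-end m) ⟩
    suc ℓ ∸ f b                       ≡⟨ cong (suc ℓ ∸_) fb≡B ⟩
    suc ℓ ∸ (b + k ∸ 1)               ≡⟨ reflect-end (mirror-sym m) ⟩
    c                                 ∎

conds-mirror : ∀ {ℓ k b c} {μ : ℕ → ℕ} → MirrorBlocks ℓ k b c → MapsInto ℓ μ →
  Conds ℓ k b μ ⇔ Conds ℓ k c (τ ℓ ℓ μ)
conds-mirror {ℓ} {μ = μ} m μ-maps =
  mk⇔ (conds-transfer m μ-maps τ-conj) (conds-transfer (mirror-sym m) maps symmetric)
  where
  τ-conj : Conjugate ℓ μ (τ ℓ ℓ μ)
  τ-conj _ _ _ = refl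
  open Conjugation μ-maps τ-conj

shift-identity : ∀ (L k b c m : ℤ) → L ℤ.+ 1ℤ ≡ k ℤ.+ b ℤ.+ c →
  ((L ℤ.- m) ℤ.- c) ℤ.+ 1ℤ ≡ (1ℤ ℤ.+ k) ℤ.- ((m ℤ.- b) ℤ.+ 1ℤ)
shift-identity L k b c m sum = begin
  ((L ℤ.- m) ℤ.- c) ℤ.+ 1ℤ              ≡⟨ regroup L m c ⟩
  ((L ℤ.+ 1ℤ) ℤ.- c) ℤ.- m              ≡⟨ cong (λ x → (x ℤ.- c) ℤ.- m) sum ⟩
  ((k ℤ.+ b ℤ.+ c) ℤ.- c) ℤ.- m         ≡⟨ cancel k b c m ⟩
  (1ℤ ℤ.+ k) ℤ.- ((m ℤ.- b) ℤ.+ 1ℤ)     ∎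
  where
  open ≡-Reasoning
  regroup : ∀ L m c → ((L ℤ.- m) ℤ.- c) ℤ.+ 1ℤ ≡ ((L ℤ.+ 1ℤ) ℤ.- c) ℤ.- m
  regroup = ℤSolver.solve-∀
  cancel : ∀ k b c m → ((k ℤ.+ b ℤ.+ c) ℤ.- c) ℤ.- m ≡ (1ℤ ℤ.+ k) ℤ.- ((m ℤ.- b) ℤ.+ 1ℤ)
  cancel = ℤSolver.solve-∀

shift-mirror : ∀ {ℓ k b c} {μ : ℕ → ℕ} → MirrorBlocks ℓ k b c → MapsInto ℓ μ →
  ∀ i → 1 ≤ i → i ≤ k → shiftSeq (τ ℓ ℓ μ) c i ≡ τℤ k k (shiftSeq μ b) i
shift-mirror {ℓ} {k} {b} {c} {μ} m μ-maps i i≥1 i≤k = begin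
  (+ (suc ℓ ∸ μ (suc ℓ ∸ (c + i ∸ 1))) ℤ.- + c) ℤ.+ 1ℤ  ≡⟨ cong (λ j → (+ (suc ℓ ∸ μ j) ℤ.- + c) ℤ.+ 1ℤ) (reflect-index m i≥1 i≤k) ⟩
  (+ (suc ℓ ∸ μ p) ℤ.- + c) ℤ.+ 1ℤ                     ≡⟨ cong (λ x → (x ℤ.- + c) ℤ.+ 1ℤ) +-∸ ⟩
  ((+ suc ℓ ℤ.- + μ p) ℤ.- + c) ℤ.+ 1ℤ                 ≡⟨ shift-identity (+ suc ℓ) (+ k) (+ b) (+ c) (+ μ p) sum ⟩
  + suc k ℤ.- ((+ μ p ℤ.- + b) ℤ.+ 1ℤ)                 ∎
  where
  open ≡-Reasoning
  p : ℕ
  p = b + (suc k ∸ i) ∸ 1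
  p-range : 1 ≤ p × p ≤ ℓ
  p-range = subst (λ j → 1 ≤ j × j ≤ ℓ) (reflect-index m i≥1 i≤k)
    (reflect-range ℓ (proj₁ (block-position m i≥1 i≤k)) (proj₂ (block-position m i≥1 i≤k)))
  μp≤1+ℓ : μ p ≤ suc ℓ
  μp≤1+ℓ = m≤n⇒m≤1+n (proj₂ (μ-maps p (proj₁ p-range) (proj₂ p-range)))
  +-∸ : + (suc ℓ ∸ μ p) ≡ + suc ℓ ℤ.- + μ p
  +-∸ = trans (sym (ℤP.⊖-≥ μp≤1+ℓ)) (sym (ℤP.m-n≡m⊖n (suc ℓ) (μ p)))
  sum : + suc ℓ ℤ.+ 1ℤ ≡ + k ℤ.+ + b ℤ.+ + c
  sum = begin
    + (suc ℓ + 1)            ≡⟨ cong +_ (trans (+-comm (suc ℓ) 1) (sym (MirrorBlocks.total m))) ⟩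
    + (k + b + c)            ≡⟨ ℤP.pos-+ (k + b) c ⟩
    + (k + b) ℤ.+ + c        ≡⟨ cong (ℤ._+ + c) (ℤP.pos-+ k b) ⟩
    + k ℤ.+ + b ℤ.+ + c      ∎

b′-mirror : ∀ {k ℓ b} → 1 ≤ k → k ≤ ℓ → 1 ≤ b → b ≤ ℓ ∸ k + 1 → MirrorBlocks ℓ k b (b′ ℓ k b)
b′-mirror {k} {ℓ} {b} k≥1 k≤ℓ b≥1 b≤ = record
  { k≥1 = k≥1 ; b≥1 = b≥1
  ; c≥1 = m<n⇒0<n∸m k+b<ℓ+2
  ; total = trans (m+[n∸m]≡n (<⇒≤ k+b<ℓ+2)) (+-comm ℓ 2) }
  where
  open ≤-Reasoning
  k+b<ℓ+2 : k + b < ℓ + 2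
  k+b<ℓ+2 = begin-strict
    k + b               ≤⟨ +-monoʳ-≤ k b≤ ⟩
    k + (ℓ ∸ k + 1)     ≡⟨ +-assoc k (ℓ ∸ k) 1 ⟨
    k + (ℓ ∸ k) + 1     ≡⟨ cong (_+ 1) (m+[n∸m]≡n k≤ℓ) ⟩
    ℓ + 1               <⟨ +-monoʳ-< ℓ ≤-refl ⟩
    ℓ + 2               ∎

mainTheorem2 : (k ℓ : ℕ) → 1 ≤ k → k ≤ ℓ →
    (b : ℕ) → 1 ≤ b → b ≤ ℓ ∸ k + 1 →
    (μ : ℕ → ℕ) → IsPartition ℓ ℓ μ →
    (Conds ℓ k b μ ⇔ Conds ℓ k (b′ ℓ k b) (τ ℓ ℓ μ)) ×
    (∀ i → 1 ≤ i → i ≤ k →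
      shiftSeq (τ ℓ ℓ μ) (b′ ℓ k b) i ≡ τℤ k k (shiftSeq μ b) i)
mainTheorem2 k ℓ k≥1 k≤ℓ b b≥1 b≤ μ (μ-maps , _) =
  conds-mirror mirror μ-maps , shift-mirror mirror μ-maps
  where
  mirror : MirrorBlocks ℓ k b (b′ ℓ k b)
  mirror = b′-mirror k≥1 k≤ℓ b≥1 b≤
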